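{- Let $\mathcal{G} = (V, E_1, \dots, E_T)$ be a public transport graph with $n \ge 2$ vertices composed of routes $\mathcal{W}_1, \dots, \mathcal{W}_m$, such that the underlying graph $U(\mathcal{G})$ is connected, and let $L = \max_{i \in [1,m]} L_i$ where $L_i = |\mathcal{W}_i|$. Assume $T \ge (2n-3)L$. Then there is an exploration of $\mathcal{G}$ (from any starting vertex) of length at most $(2n-3)L$.
   Context: A temporal graph $\mathcal{G} = (V, E_1,\dots,E_T)$ has vertex set $V$ and edge sets $E_1,\dots,E_T$; its underlying graph is $U(\mathcal{G}) = (V, \bigcup_t E_t)$. A temporal walk is a sequence $((v_{i_1},v_{i_2}),t_1), \dots, ((v_{i_{k-1}},v_{i_k}),t_{k-1})$ of edge–timestep pairs whose edges form a walk and with $t_1<\dots<t_{k-1}$; its length is $t_{k-1}$. A public transport graph with lifetime $T$ is defined by temporal walks (routes) $\mathcal{W}_1,\dots,\mathcal{W}_m$ over $V$: writing $L_i = |\mathcal{W}_i|$ (the last timestep used by $\mathcal{W}_i$) and $\mathcal{W}_i[j] = (e_{i,j}, t_{i,j})$ for its $j$-th step, an edge $e$ belongs to $E_t$ iff there exist $i, j$ with $e = e_{i,j}$ and $t_{i,j} \equiv t \pmod{L_i}$ (each route repeats periodically). An exploration of $\mathcal{G}$ starting at $v$ is a temporal walk in $\mathcal{G}$ starting at $v$ such that every vertex lies on some edge of the walk. -}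

module Defs where

open import Data.Nat using (ℕ; zero; suc; _+_; _*_; _∸_; _≤_; _<_; _⊔_)
open import Data.Fin using (Fin)
open import Data.Product using (Σ; ∃; ∃-syntax; _×_; _,_)
open import Data.Sum using (_⊎_)
open import Data.Unit using (⊤)
open import Data.List using (List; []; _∷_)
open import Data.List.Membership.Propositional using (_∈_)
open import Relation.Binary.PropositionalEquality using (_≡_; _≢_)

-- A step of a temporal walk: ((a , b) , t), i.e. the edge from a to b taken at timestep t.
Step : ℕ → Set
Step n = Fin n × Fin n × ℕ

WalkFrom : {n : ℕ} → Fin n → ℕ → List (Step n) → Set
WalkFrom v p [] = ⊤
WalkFrom v p ((a , b , t) ∷ s) = (a ≡ v) × (p < t) × WalkFrom b t s

TemporalWalkFrom : {n : ℕ} → Fin n → List (Step n) → Set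
TemporalWalkFrom v s = WalkFrom v 0 s

-- Length of a temporal walk = its last timestep (0 for the empty walk).
walkLength : {n : ℕ} → List (Step n) → ℕ
walkLength [] = 0
walkLength ((a , b , t) ∷ []) = t
walkLength (_ ∷ s@(_ ∷ _)) = walkLength s

ProperSteps : {n : ℕ} → List (Step n) → Set
ProperSteps [] = ⊤
ProperSteps ((a , b , t) ∷ s) = (a ≢ b) × ProperSteps s

record Route (n : ℕ) : Set where
  constructor mkRoute
  field
    start    : Fin n
    steps    : List (Step n)
    isWalk   : TemporalWalkFrom start steps
    proper   : ProperSteps steps
    nonempty : steps ≢ []

open Route public

routeLength : {n : ℕ} → Route n → ℕ
routeLength W = walkLength (steps W)

ModEq : ℕ → ℕ → ℕ → Set
ModEq L a b = ∃[ k ] ((a ≡ b + k * L) ⊎ (b ≡ a + k * L))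

-- The (undirected) edge {u,v} belongs to E_t (1 ≤ t ≤ T) iff some route i has
-- a step j whose edge is {u,v} and whose timestep t_{i,j} ≡ t (mod L_i).
EdgeAt : {n m : ℕ} → (Fin m → Route n) → ℕ → Fin n → Fin n → ℕ → Set
EdgeAt W T u v t =
  (1 ≤ t) × (t ≤ T) ×
  ∃[ i ] ∃[ a ] ∃[ b ] ∃[ t' ]
    (((a , b , t') ∈ steps (W i)) ×
     (((a ≡ u) × (b ≡ v)) ⊎ ((a ≡ v) × (b ≡ u))) ×
     ModEq (routeLength (W i)) t' t)

UEdge : {n m : ℕ} → (Fin m → Route n) → ℕ → Fin n → Fin n → Set
UEdge W T u v = ∃[ t ] EdgeAt W T u v t

data Reach {n m : ℕ} (W : Fin m → Route n) (T : ℕ) : Fin n → Fin n → Set where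
  here : ∀ {u} → Reach W T u u
  there : ∀ {u v w} → UEdge W T u v → Reach W T v w → Reach W T u w

Connected : {n m : ℕ} → (Fin m → Route n) → ℕ → Set
Connected W T = ∀ u v → Reach W T u v

StepsInGraph : {n m : ℕ} → (Fin m → Route n) → ℕ → List (Step n) → Set
StepsInGraph W T [] = ⊤
StepsInGraph W T ((a , b , t) ∷ s) = EdgeAt W T a b t × StepsInGraph W T s

Covers : {n : ℕ} → List (Step n) → Fin n → Set
Covers s x = ∃[ a ] ∃[ b ] ∃[ t ] (((a , b , t) ∈ s) × ((x ≡ a) ⊎ (x ≡ b)))

Exploration : {n m : ℕ} → (Fin m → Route n) → ℕ → Fin n → List (Step n) → Set
Exploration W T v s =
  TemporalWalkFrom v s × StepsInGraph W T s × (∀ x → Covers s x)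

maxOver : (m : ℕ) → (Fin m → ℕ) → ℕ
maxOver zero f = 0
maxOver (suc m) f = f Fin.zero ⊔ maxOver m (λ i → f (Fin.suc i))

-- Every edge of U(G) is present at least once in every window of L consecutive
-- timesteps, since each route repeats with period at most L. Hence a walk of k
-- edges in U(G) can be followed in the temporal graph within k L timesteps, one
-- window per edge. It remains to find a walk in U(G) of at most 2n − 3 edges that
-- visits every vertex: grow it greedily from v, each time inserting a detour
-- a → b → a to an unvisited neighbour b of a visited vertex a (two edges per new
-- vertex), except for the very first new vertex, which costs a single edge.
module Submission where

open import Defs
open import Data.Nat using (ℕ; zero; suc; _+_; _*_; _∸_; _≤_; _<_; z≤n; s≤s; _<?_)
open import Data.Nat.Properties hiding (_≟_)
open import Data.Nat.Induction using (<-wellFounded)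
open import Data.Nat.Tactic.RingSolver using (solve-∀)
open import Data.Fin using (Fin; punchIn; _≟_)
open import Data.Fin.Properties using (punchInᵢ≢i)
open import Data.Fin.Subset using (Subset; ∁; ⁅_⁆; ∣_∣; _-_)
  renaming (_∈_ to _∈ˢ_; _∉_ to _∉ˢ_; ⊥ to ∅)
open import Data.Fin.Subset.Properties
  using (_∈?_; nonempty?; ∉⊥; x∈⁅x⁆; x∈⁅y⁆⇒x≡y; x≢y⇒x∉⁅y⁆;
         x∈p⇒x∉∁p; x∉∁p⇒x∈p; x∉p⇒x∈∁p; ∣∁p∣≡n∸∣p∣; ∣⁅x⁆∣≡1;
         x∈p∧x≢y⇒x∈p-y; x∈p⇒∣p-x∣<∣p∣; p─q⊆p)
open import Data.Product using (Σ-syntax; ∃-syntax; ∃₂; _×_; _,_)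
open import Data.Sum using (_⊎_; inj₁; inj₂; swap)
open import Data.Unit using (tt)
open import Data.List using (List; []; _∷_; length)
open import Data.List.Membership.Propositional using (_∈_)
open import Data.List.Relation.Unary.Any using (here; there)
open import Data.List.Relation.Unary.Linked using (Linked; []; [-]; _∷_)
open import Induction.WellFounded using (Acc; acc)
open import Relation.Binary.Core using (Rel)
open import Relation.Binary.Definitions using (Symmetric)
open import Relation.Binary.Construct.Closure.ReflexiveTransitive using (Star; ε; _◅_)
open import Relation.Nullary using (¬_; yes; no; contradiction)
open import Relation.Unary using (Pred; Decidable)
open import Function using (_∘_)
open import Relation.Binary.PropositionalEquality using (_≡_; _≢_; refl; sym; trans; cong; subst; module ≡-Reasoning)

WalkFrom-weaken : ∀ {n} {v : Fin n} {p q} (s : List (Step n)) → p ≤ q → WalkFrom v q s → WalkFrom v p s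
WalkFrom-weaken []                p≤q _                  = tt
WalkFrom-weaken ((a , b , t) ∷ s) p≤q (a≡v , q<t , walk) = a≡v , ≤-<-trans p≤q q<t , walk

<-walkLength : ∀ {n} {v : Fin n} {p} (x : Step n) (s : List (Step n)) →
  WalkFrom v p (x ∷ s) → p < walkLength (x ∷ s)
<-walkLength (a , b , t) []      (_ , p<t , _)    = p<t
<-walkLength (a , b , t) (y ∷ s) (_ , p<t , walk) = <-trans p<t (<-walkLength y s walk)

timestep-bounds : ∀ {n} {v : Fin n} {p a b t} (s : List (Step n)) →
  (a , b , t) ∈ s → WalkFrom v p s → p < t × t ≤ walkLength s
timestep-bounds (_ ∷ [])      (here refl) (_ , p<t , _)    = p<t , ≤-refl
timestep-bounds (_ ∷ (y ∷ s)) (here refl) (_ , p<t , walk) = p<t , <⇒≤ (<-walkLength y s walk)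
timestep-bounds (_ ∷ (y ∷ s)) (there x∈s) (_ , p<t , walk) =
  let t'<t , t≤len = timestep-bounds (y ∷ s) x∈s walk in <-trans p<t t'<t , t≤len

walkLength-∷-≤ : ∀ {n B} (a b : Fin n) (t : ℕ) (s : List (Step n)) →
  t ≤ B → walkLength s ≤ B → walkLength ((a , b , t) ∷ s) ≤ B
walkLength-∷-≤ a b t []      t≤B _      = t≤B
walkLength-∷-≤ a b t (_ ∷ s) _   len≤B = len≤B

covered-start : ∀ {n} {v z : Fin n} {p} {s : List (Step n)} → WalkFrom v p s → Covers s z → Covers s v
covered-start {s = (a , b , t) ∷ _} (refl , _) _ = a , b , t , here refl , inj₁ refl

periodic-hit : ∀ {r d} → 0 < r → r ≤ d → ∀ s → ∃[ k ] (s < r + k * d × r + k * d ≤ s + d)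
periodic-hit {r} 0<r r≤d zero =
  0 , ≤-trans 0<r (m≤m+n r 0) , ≤-trans (≤-reflexive (+-identityʳ r)) r≤d
periodic-hit {r} {d} 0<r r≤d (suc s) with periodic-hit 0<r r≤d s
... | k , s<hit , hit≤s+d with suc s <? r + k * d
...   | yes below = k , below , ≤-trans hit≤s+d (n≤1+n _)
...   | no ¬below = suc k , ≤-trans (m<m+n (suc s) (≤-trans 0<r r≤d)) (≤-reflexive (sym next)) , ≤-reflexive next
  where
    open ≡-Reasoning
    next : r + suc k * d ≡ suc s + d
    next = begin
      r + (d + k * d) ≡⟨ cong (r +_) (+-comm d (k * d)) ⟩
      r + (k * d + d) ≡⟨ +-assoc r (k * d) d ⟨
      r + k * d + d   ≡⟨ cong (_+ d) (≤-antisym (≮⇒≥ ¬below) s<hit) ⟩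
      suc s + d       ∎

maxOver-upper : ∀ m (f : Fin m → ℕ) (i : Fin m) → f i ≤ maxOver m f
maxOver-upper (suc m) f Fin.zero    = m≤m⊔n _ _
maxOver-upper (suc m) f (Fin.suc i) = ≤-trans (maxOver-upper m (λ j → f (Fin.suc j)) i) (m≤n⊔m _ _)

other-vertex : ∀ {n} → 2 ≤ n → (v : Fin n) → ∃[ w ] w ≢ v
other-vertex {suc zero}    (s≤s ()) _
other-vertex {suc (suc _)} _        v = punchIn v Fin.zero , punchInᵢ≢i v Fin.zero

Star-crossing : ∀ {a r p} {A : Set a} {R : Rel A r} {P : Pred A p} → Decidable P →
  ∀ {x y} → Star R x y → ¬ P x → P y → ∃₂ λ u w → ¬ P u × P w × R u w
Star-crossing P? ε                    ¬Px Py = contradiction Py ¬Px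
Star-crossing P? (_◅_ {j = z} e path) ¬Px Py with P? z
... | yes Pz = _ , _ , ¬Px , Pz , e
... | no ¬Pz = Star-crossing P? path ¬Pz Py

∉∁⁅x⁆ : ∀ {n} (x : Fin n) → x ∉ˢ ∁ ⁅ x ⁆
∉∁⁅x⁆ x = x∈p⇒x∉∁p (x∈⁅x⁆ x)

∉∁⁅y⁆⇒≡ : ∀ {n} {x y : Fin n} → x ∉ˢ ∁ ⁅ y ⁆ → x ≡ y
∉∁⁅y⁆⇒≡ {y = y} x∉ = x∈⁅y⁆⇒x≡y y (x∉∁p⇒x∈p x∉)

≢⇒∈∁⁅y⁆ : ∀ {n} {x y : Fin n} → x ≢ y → x ∈ˢ ∁ ⁅ y ⁆
≢⇒∈∁⁅y⁆ x≢y = x∉p⇒x∈∁p (x≢y⇒x∉⁅y⁆ x≢y)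

∣∁⁅x⁆∣ : ∀ {n} (x : Fin n) → ∣ ∁ ⁅ x ⁆ ∣ ≡ n ∸ 1
∣∁⁅x⁆∣ {n} x = trans (∣∁p∣≡n∸∣p∣ ⁅ x ⁆) (cong (n ∸_) (∣⁅x⁆∣≡1 x))

∉-minus⁻ : ∀ {n} {u : Subset n} {b z} → z ∉ˢ u - b → z ≡ b ⊎ z ∉ˢ u
∉-minus⁻ {b = b} {z} z∉u-b with z ≟ b
... | yes z≡b = inj₁ z≡b
... | no z≢b  = inj₂ λ z∈u → z∉u-b (x∈p∧x≢y⇒x∈p-y z∈u z≢b)

module _ {ℓ} {A : Set ℓ} where

  detour : ∀ {a} (b x : A) (xs : List A) → a ∈ x ∷ xs → List A
  detour b x xs       (here _)  = b ∷ x ∷ xs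
  detour b x (y ∷ xs) (there p) = y ∷ detour b y xs p

  Linked-detour : ∀ {r} {R : Rel A r} {a b x xs} → R a b → R b a → (p : a ∈ x ∷ xs) →
    Linked R (x ∷ xs) → Linked R (x ∷ detour b x xs p)
  Linked-detour Rab Rba (here refl) path         = Rab ∷ Rba ∷ path
  Linked-detour Rab Rba (there p)   (Rxy ∷ path) = Rxy ∷ Linked-detour Rab Rba p path

  length-detour : ∀ {a} b x xs (p : a ∈ x ∷ xs) → length (detour b x xs p) ≡ 2 + length xs
  length-detour b x xs       (here _)  = refl
  length-detour b x (y ∷ xs) (there p) = cong suc (length-detour b y xs p)

  ∈-detour⁺ : ∀ {a z} b x xs (p : a ∈ x ∷ xs) → z ∈ x ∷ xs → z ∈ x ∷ detour b x xs p
  ∈-detour⁺ b x xs       (here _)  (here z≡x)  = here z≡x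
  ∈-detour⁺ b x xs       (here _)  (there z∈)  = there (there (there z∈))
  ∈-detour⁺ b x (y ∷ xs) (there p) (here z≡x)  = here z≡x
  ∈-detour⁺ b x (y ∷ xs) (there p) (there z∈)  = there (∈-detour⁺ b y xs p z∈)

  detour-∈ : ∀ {a} b x xs (p : a ∈ x ∷ xs) → b ∈ x ∷ detour b x xs p
  detour-∈ b x xs       (here _)  = there (here refl)
  detour-∈ b x (y ∷ xs) (there p) = there (detour-∈ b y xs p)

detour-budget : ∀ l {k j} → k < j → 2 + l + 2 * k ≤ l + 2 * j
detour-budget l {k} k<j = ≤-trans (≤-reflexive (regroup l k)) (+-monoʳ-≤ l (*-monoʳ-≤ 2 k<j))
  where
    regroup : ∀ l k → 2 + l + 2 * k ≡ l + 2 * suc k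
    regroup = solve-∀

first-hop-budget : ∀ {n k} → k < n ∸ 1 → 1 + 2 * k ≤ 2 * n ∸ 3
first-hop-budget {n} {k} k<n-1 =
  m+n≤o⇒m≤o∸n (1 + 2 * k) (≤-trans (≤-reflexive (regroup k)) (*-monoʳ-≤ 2 k+2≤n))
  where
    regroup : ∀ k → 1 + 2 * k + 3 ≡ 2 * (suc k + 1)
    regroup = solve-∀
    k+2≤n : suc k + 1 ≤ n
    k+2≤n = m≤o∸n⇒m+n≤o (suc k) (≤-trans (≤-trans (s≤s z≤n) k<n-1) (m∸n≤m n 1)) k<n-1

module SpanningWalk {ℓ} {n : ℕ} (E : Rel (Fin n) ℓ) (E-sym : Symmetric E)
                    (connected : ∀ u v → Star E u v) where

  record Tour (v : Fin n) (u : Subset n) : Set ℓ where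
    field
      hops   : List (Fin n)
      linked : Linked E (v ∷ hops)
      visits : ∀ {z} → z ∉ˢ u → z ∈ v ∷ hops

  open Tour

  extend : ∀ {v u a b} (t : Tour v u) → E a b → a ∉ˢ u →
    Σ[ t' ∈ Tour v (u - b) ] length (hops t') ≡ 2 + length (hops t)
  extend {v} {u} {a} {b} t Eab a∉u = extended , length-detour b v (hops t) a∈t
    where
      a∈t = visits t a∉u
      visits' : ∀ {z} → z ∉ˢ u - b → z ∈ v ∷ detour b v (hops t) a∈t
      visits' z∉ with ∉-minus⁻ z∉
      ... | inj₁ refl = detour-∈ b v (hops t) a∈t
      ... | inj₂ z∉u  = ∈-detour⁺ b v (hops t) a∈t (visits t z∉u)
      extended : Tour v (u - b)
      extended = record
        { hops   = detour b v (hops t) a∈t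
        ; linked = Linked-detour Eab (E-sym Eab) a∈t (linked t)
        ; visits = visits'
        }

  complete : ∀ {v u} (t : Tour v u) → v ∉ˢ u → Acc _<_ ∣ u ∣ →
    Σ[ t' ∈ Tour v ∅ ] length (hops t') ≤ length (hops t) + 2 * ∣ u ∣
  complete {v} {u} t v∉u (acc smaller) with nonempty? u
  ... | no empty = finished , m≤m+n _ _
    where
      finished : Tour v ∅
      finished = record { hops = hops t ; linked = linked t ; visits = λ _ → visits t (λ z∈u → empty (_ , z∈u)) }
  ... | yes (w , w∈u) with Star-crossing (_∈? u) (connected v w) v∉u w∈u
  ...   | a , b , a∉u , b∈u , Eab =
    let t' , len-t'   = extend t Eab a∉u
        b-removed     = x∈p⇒∣p-x∣<∣p∣ b∈u
        t'' , len-t'' = complete t' (v∉u ∘ p─q⊆p u ⁅ b ⁆) (smaller b-removed)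
    in t'' , (begin
      length (hops t'')                   ≤⟨ len-t'' ⟩
      length (hops t') + 2 * ∣ u - b ∣    ≡⟨ cong (λ l → l + 2 * ∣ u - b ∣) len-t' ⟩
      2 + length (hops t) + 2 * ∣ u - b ∣ ≤⟨ detour-budget (length (hops t)) b-removed ⟩
      length (hops t) + 2 * ∣ u ∣         ∎)
    where open ≤-Reasoning

  first-tour : 2 ≤ n → ∀ v → ∃₂ λ u (t : Tour v u) → v ∉ˢ u × length (hops t) ≡ 1 × ∣ u ∣ < n ∸ 1
  first-tour 2≤n v with other-vertex 2≤n v
  ... | w , w≢v with Star-crossing (_∈? ∁ ⁅ v ⁆) (connected v w) (∉∁⁅x⁆ v) (≢⇒∈∁⁅y⁆ w≢v)
  ...   | a , b , a∉ , b∈ , Eab = ∁ ⁅ v ⁆ - b , first , ∉∁⁅x⁆ v ∘ p─q⊆p _ ⁅ b ⁆ , refl , b-removed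
    where
      visits-first : ∀ {z} → z ∉ˢ ∁ ⁅ v ⁆ - b → z ∈ v ∷ b ∷ []
      visits-first z∉ with ∉-minus⁻ z∉
      ... | inj₁ z≡b = there (here z≡b)
      ... | inj₂ z∉  = here (∉∁⁅y⁆⇒≡ z∉)
      first : Tour v (∁ ⁅ v ⁆ - b)
      first = record
        { hops   = b ∷ []
        ; linked = subst (λ x → E x b) (∉∁⁅y⁆⇒≡ a∉) Eab ∷ [-]
        ; visits = visits-first
        }
      b-removed : ∣ ∁ ⁅ v ⁆ - b ∣ < n ∸ 1
      b-removed = subst (∣ ∁ ⁅ v ⁆ - b ∣ <_) (∣∁⁅x⁆∣ v) (x∈p⇒∣p-x∣<∣p∣ b∈)

  spanning-walk : 2 ≤ n → ∀ v → ∃[ ys ]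
    (Linked E (v ∷ ys) × ys ≢ [] × (∀ z → z ∈ v ∷ ys) × length ys ≤ 2 * n ∸ 3)
  spanning-walk 2≤n v with first-tour 2≤n v
  ... | u , t₁ , v∉u , len-t₁ , u<n-1 with complete t₁ v∉u (<-wellFounded _)
  ... | t , len-t = hops t , linked t , hops≢[] , visits-all , bound
    where
      visits-all : ∀ z → z ∈ v ∷ hops t
      visits-all z = visits t ∉⊥
      bound : length (hops t) ≤ 2 * n ∸ 3
      bound = ≤-trans (subst (λ l → length (hops t) ≤ l + 2 * ∣ u ∣) len-t₁ len-t) (first-hop-budget {n} u<n-1)
      hops≢[] : hops t ≢ []
      hops≢[] empty with other-vertex 2≤n v
      ... | w , w≢v with subst (λ hs → w ∈ v ∷ hs) empty (visits-all w)
      ...   | here w≡v = w≢v w≡v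

maxRouteLength : ∀ {n m} → (Fin m → Route n) → ℕ
maxRouteLength {m = m} W = maxOver m (λ i → routeLength (W i))

module _ {n m : ℕ} (W : Fin m → Route n) (T : ℕ) where

  private
    L = maxRouteLength W

  UEdge-sym : Symmetric (UEdge W T)
  UEdge-sym (t , 1≤t , t≤T , i , a , b , t' , ∈W , orientation , t'≡t) =
    t , 1≤t , t≤T , i , a , b , t' , ∈W , swap orientation , t'≡t

  Reach⇒Star : ∀ {u v} → Reach W T u v → Star (UEdge W T) u v
  Reach⇒Star here         = ε
  Reach⇒Star (there e r) = e ◅ Reach⇒Star r

  UEdge-in-window : ∀ {u v} → UEdge W T u v → ∀ s → s + L ≤ T →
    ∃[ t ] (s < t × t ≤ s + L × EdgeAt W T u v t)
  UEdge-in-window (_ , _ , _ , i , a , b , t' , ∈W , orientation , _) s s+L≤T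
    with timestep-bounds (steps (W i)) ∈W (isWalk (W i))
  ... | 0<t' , t'≤Lᵢ with periodic-hit 0<t' t'≤Lᵢ s
  ... | k , s<t , t≤s+Lᵢ =
    t , s<t , t≤s+L , ≤-trans (s≤s z≤n) s<t , ≤-trans t≤s+L s+L≤T , i , a , b , t' , ∈W , orientation , k , inj₂ refl
    where
      t = t' + k * routeLength (W i)
      t≤s+L = ≤-trans t≤s+Lᵢ (+-monoʳ-≤ s (maxOver-upper m (λ j → routeLength (W j)) i))

  follow-path : ∀ x ys → Linked (UEdge W T) (x ∷ ys) → ∀ s → s + length ys * L ≤ T →
    ∃[ st ] (WalkFrom x s st × StepsInGraph W T st × walkLength st ≤ s + length ys * L ×
             (∀ {z} → z ∈ ys → Covers st z))
  follow-path x []       _          s _      = [] , tt , tt , z≤n , λ ()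
  follow-path x (y ∷ ys) (e ∷ path) s budget =
    let regroup                            = +-assoc s L (length ys * L)
        t , s<t , t≤s+L , edge             = UEdge-in-window e s (≤-trans (+-monoʳ-≤ s (m≤m+n L _)) budget)
        st , walk , inGraph , len , covers = follow-path y ys path (s + L) (≤-trans (≤-reflexive regroup) budget)
    in (x , y , t) ∷ st , (refl , s<t , WalkFrom-weaken st t≤s+L walk) , (edge , inGraph) ,
       walkLength-∷-≤ x y t st (≤-trans t≤s+L (+-monoʳ-≤ s (m≤m+n L _))) (≤-trans len (≤-reflexive regroup)) ,
       λ { (here refl)  → x , y , t , here refl , inj₂ refl
         ; (there z∈ys) → let a , b , t′ , ∈st , ends = covers z∈ys in a , b , t′ , there ∈st , ends }

mainTheorem10 : (n m : ℕ) (W : Fin m → Route n) (T : ℕ) →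
    2 ≤ n →
    Connected W T →
    (2 * n ∸ 3) * maxOver m (λ i → routeLength (W i)) ≤ T →
    (v : Fin n) →
    ∃[ s ] (Exploration W T v s ×
            walkLength s ≤ (2 * n ∸ 3) * maxOver m (λ i → routeLength (W i)))
mainTheorem10 n m W T 2≤n connected budget v
  with SpanningWalk.spanning-walk (UEdge W T) (UEdge-sym W T) (λ x y → Reach⇒Star W T (connected x y)) 2≤n v
... | [] , _ , ys≢[] , _ = contradiction refl ys≢[]
... | y ∷ ys , path , _ , spans , short
  with follow-path W T v (y ∷ ys) path 0 (≤-trans (*-monoˡ-≤ (maxRouteLength W) short) budget)
... | st , walk , inGraph , len , covers =
  st , (walk , inGraph , coverage) , ≤-trans len (*-monoˡ-≤ (maxRouteLength W) short)
  where
    coverage : ∀ z → Covers st z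
    coverage z with spans z
    ... | here refl  = covered-start walk (covers (here refl))
    ... | there z∈ys = covers z∈ys
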